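{- Let $(\mathbb{Z}^n,E)$ be a PL graph with edge vectors $v_1,\dots,v_k$ and let $S\subset\mathbb{Z}^n$ be a finite set with $\mathrm{gap}_{v_i}(S)=\emptyset$ for each $i=1,\dots,k$. Then $$|\partial_e(S)|=2\sum_{i=1}^k|P_{v_i}(S)|.$$
   Context: A PL graph is a simple graph $G=(V,E)$ with $V=\mathbb{Z}^n$ for which there exist integer vectors $v_1,\dots,v_k$ with $v_i\neq -v_j$ for all $i,j$, such that for every $u\in\mathbb{Z}^n$ the edges containing $u$ are exactly $(u,u\pm v_1),\dots,(u,u\pm v_k)$; each $v_i$ has relatively prime entries; and $v_1,\dots,v_k$ span $\mathbb{R}^n$. The edge boundary is $\partial_e(S)=\{(u,v)\in E:|\{u,v\}\cap S|=1\}$. $P_{v_i}(S)=\{u-\frac{\langle u,v_i\rangle}{\|v_i\|_2^2}v_i: u\in S\}$ is the orthogonal projection of $S$ onto the hyperplane perpendicular to $v_i$. $\mathrm{gap}_{v_i}(S)=\{x\in\mathbb{Z}^n: x-v_i\in S,\ x\notin S,\ x+bv_i\in S\text{ for some integer }b\ge1\}$. -}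

module Defs where

open import Data.Nat as ℕ using (ℕ; zero; suc)
open import Data.Nat.GCD using (gcd)
open import Data.Integer as ℤ using (ℤ; ∣_∣)
open import Data.Rational as ℚ using (ℚ)
open import Data.Fin using (Fin)
open import Data.Vec as Vec using (Vec; zipWith; foldr)
open import Data.List using (List; length)
open import Data.List.Membership.Propositional using (_∈_)
open import Data.List.Relation.Unary.Unique.Propositional using (Unique)
open import Data.Product using (Σ; ∃; _×_; _,_)
open import Data.Sum using (_⊎_)
open import Function.Bundles using (_⇔_)
open import Relation.Binary.PropositionalEquality using (_≡_)
open import Relation.Nullary using (¬_)

Pt : ℕ → Set
Pt n = Vec ℤ n

infixl 6 _⊕_ _⊖_
_⊕_ : ∀ {n} → Pt n → Pt n → Pt n
_⊕_ = zipWith ℤ._+_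

_⊖_ : ∀ {n} → Pt n → Pt n → Pt n
_⊖_ = zipWith ℤ._-_

neg : ∀ {n} → Pt n → Pt n
neg = Vec.map (λ a → ℤ.- a)

_·_ : ∀ {n} → ℤ → Pt n → Pt n
c · x = Vec.map (c ℤ.*_) x

inner : ∀ {n} → Pt n → Pt n → ℤ
inner u v = foldr _ ℤ._+_ (ℤ.+ 0) (zipWith ℤ._*_ u v)

normSq : ∀ {n} → Pt n → ℕ
normSq v = ∣ inner v v ∣

gcdEntries : ∀ {n} → Pt n → ℕ
gcdEntries v = foldr _ (λ a g → gcd ∣ a ∣ g) 0 v

Primitive : ∀ {n} → Pt n → Set
Primitive v = gcdEntries v ≡ 1

-- the coefficient ⟨u,v⟩ / ‖v‖² (as a rational); only used for v ≠ 0,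
-- the value 0 for v = 0 is an irrelevant convention
projCoef : ∀ {n} → Pt n → Pt n → ℚ
projCoef u v with normSq v
... | zero  = ℚ.0ℚ
... | suc m = inner u v ℚ./ suc m

proj : ∀ {n} → Pt n → Pt n → Vec ℚ n
proj v u = zipWith (λ ui vi → ℚ._-_ (ui ℚ./ 1) (ℚ._*_ (projCoef u v) (vi ℚ./ 1))) u v

-- v_1,…,v_k span ℝ^n (equivalently ℚ^n, as they are integer vectors):
-- every integer vector has a nonzero integer multiple that is an
-- integer linear combination of the v_i.
linComb : ∀ {n k} → (Fin k → ℤ) → (Fin k → Pt n) → Pt n
linComb {n} {zero}  c v = Vec.replicate n (ℤ.+ 0)
linComb {n} {suc k} c v = (c Fin.zero · v Fin.zero) ⊕ linComb (λ i → c (Fin.suc i)) (λ i → v (Fin.suc i))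
  where import Data.Fin as Fin

Spans : ∀ {n k} → (Fin k → Pt n) → Set
Spans {n} {k} v = ∀ (x : Pt n) → Σ ℤ λ d → ¬ (d ≡ ℤ.+ 0) × Σ (Fin k → ℤ) λ c → linComb c v ≡ d · x

record IsPL {n k : ℕ} (v : Fin k → Pt n) : Set where
  field
    notOpp    : ∀ i j → ¬ (v i ≡ neg (v j))
    distinct  : ∀ i j → v i ≡ v j → i ≡ j
    coprime   : ∀ i → Primitive (v i)
    spans     : Spans v

Adj : ∀ {n k} → (Fin k → Pt n) → Pt n → Pt n → Set
Adj v a b = ∃ λ i → (b ≡ a ⊕ v i) ⊎ (b ≡ a ⊖ v i)

-- finite sets are given by lists (duplicates allowed); membership is _∈_
-- gap_v(S)
InGap : ∀ {n} → Pt n → List (Pt n) → Pt n → Set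
InGap v S x = (x ⊖ v) ∈ S × ¬ (x ∈ S) × Σ ℕ λ b → (1 ℕ.≤ b) × ((x ⊕ ((ℤ.+ b) · v)) ∈ S)

GapEmpty : ∀ {n} → Pt n → List (Pt n) → Set
GapEmpty v S = ∀ x → ¬ InGap v S x

HasCard : {A : Set} → (A → Set) → ℕ → Set
HasCard {A} P m = Σ (List A) λ L → Unique L × (∀ x → (x ∈ L) ⇔ P x) × length L ≡ m

-- edges of ∂_e(S), each edge {a,b} represented by the oriented pair (a,b) with a ∈ S, b ∉ S
BoundaryEdge : ∀ {n k} → (Fin k → Pt n) → List (Pt n) → Pt n × Pt n → Set
BoundaryEdge v S (a , b) = Adj v a b × a ∈ S × ¬ (b ∈ S)

InProj : ∀ {n} → Pt n → List (Pt n) → Vec ℚ n → Set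
InProj v S y = ∃ λ u → u ∈ S × proj v u ≡ y

-- Since vᵢ is primitive, two integer points have the same projection P_{vᵢ} exactly when
-- they differ by an integer multiple of vᵢ, so the fibres of P_{vᵢ} on S are the
-- intersections of S with the lines a + ℤvᵢ. An empty gap set makes each of these a
-- segment, which has exactly one top point a (with a + vᵢ ∉ S) and one bottom point
-- (with a − vᵢ ∉ S). Hence each of the directions vᵢ and −vᵢ contributes |P_{vᵢ}(S)| edges,
-- and no edge is counted twice because the vectors ±vᵢ are pairwise distinct.
module Submission where

open import Defs
open import Data.Nat as ℕ using (ℕ; zero; suc; _*_; s≤s; z≤n)
import Data.Nat.Properties as ℕₚ
import Data.Nat.Tactic.RingSolver as ℕ-Solver
open import Data.Nat.Divisibility using (_∣_; divides)
open import Data.Nat.GCD using (gcd; gcd-greatest; c*gcd[m,n]≡gcd[cm,cn])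
open import Data.Integer as ℤ using (ℤ; +_; -[1+_]; ∣_∣)
import Data.Integer.Properties as ℤₚ
open import Data.Integer.Divisibility.Signed using (∣ᵤ⇒∣; divides)
open import Data.Integer.Tactic.RingSolver using (solve-∀)
open import Algebra.Properties.AbelianGroup ℤₚ.+-0-abelianGroup using () renaming (∙-cancelˡ to +-cancelˡ)
open import Data.Rational as ℚ using (_/_)
import Data.Rational.Properties as ℚₚ
open import Data.Rational.Unnormalised as ℚᵘ using (mkℚᵘ; *≡*)
import Data.Rational.Unnormalised.Properties as ℚᵘₚ
open import Data.Fin using (Fin; zero; suc)
open import Data.Fin.Properties using (suc-injective)
open import Data.Vec as Vec using (Vec; []; _∷_; zipWith; sum; tabulate)
open import Data.Vec.Properties using (∷-injectiveˡ; ∷-injectiveʳ; ≡-dec)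
open import Data.List using (List; []; _∷_; _++_; map; length; filter; deduplicate)
open import Data.List.Properties using (length-map; length-++)
open import Data.List.Extrema ℤₚ.≤-totalOrder using (argmax; argmax-all; f[xs]≤f[argmax])
open import Data.List.Membership.Propositional using (_∈_; _∉_)
open import Data.List.Membership.Propositional.Properties
  using (∈-map⁺; ∈-map⁻; ∈-filter⁺; ∈-filter⁻; ∈-deduplicate⁺; ∈-deduplicate⁻; ∈-++⁺ˡ; ∈-++⁺ʳ; ∈-++⁻)
open import Data.List.Membership.Propositional.Properties.WithK using (unique∧set⇒bag)
open import Data.List.Relation.Binary.BagAndSetEquality using (∼bag⇒↭)
open import Data.List.Relation.Binary.Permutation.Propositional.Properties using (↭-length)
open import Data.List.Relation.Unary.All as All using ()
open import Data.List.Relation.Unary.Any using (here; there)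
open import Data.List.Relation.Unary.AllPairs using ([]; _∷_)
open import Data.List.Relation.Unary.Unique.Propositional using (Unique)
open import Data.List.Relation.Unary.Unique.Propositional.Properties using (++⁺; map⁺)
open import Data.Product using (Σ; ∃; _×_; _,_; proj₁; proj₂)
open import Data.Sum using (_⊎_; inj₁; inj₂)
open import Data.Empty using (⊥; ⊥-elim)
open import Function using (_∘_)
open import Function.Bundles using (_⇔_; mk⇔; Equivalence)
open import Function.Construct.Composition using (_⇔-∘_)
open import Function.Construct.Symmetry using (⇔-sym)
open import Relation.Nullary.Decidable using (decidable-stable)
open import Relation.Binary.PropositionalEquality

module _ {n : ℕ} where
  open import Data.List.Membership.DecPropositional (≡-dec {n = n} ℤ._≟_) public using (_∈?_; _∉?_)
  open import Data.List.Relation.Unary.Unique.DecPropositional.Properties (≡-dec {n = n} ℤ._≟_) public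
    using (deduplicate-!)

module _ {A : Set} where

  HasCard-length : ∀ {P : A → Set} {p} {xs : List A} →
                   HasCard P p → Unique xs → (∀ {x} → x ∈ xs ⇔ P x) → length xs ≡ p
  HasCard-length {xs = xs} (ys , ys-unique , ∈ys⇔P , |ys|≡p) xs-unique ∈xs⇔P =
    trans (↭-length (∼bag⇒↭ (unique∧set⇒bag xs-unique ys-unique same-members))) |ys|≡p
    where
    same-members : ∀ {x} → x ∈ xs ⇔ x ∈ ys
    same-members {x} = ⇔-sym (∈ys⇔P x) ⇔-∘ ∈xs⇔P

module _ {A B : Set} (f : A → B) where

  Unique-map⁺ : ∀ {xs : List A} → Unique xs → (∀ {x y} → x ∈ xs → y ∈ xs → f x ≡ f y → x ≡ y) →
                Unique (map f xs)
  Unique-map⁺ {[]}     []                   _         = []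
  Unique-map⁺ {x ∷ xs} (x∉xs ∷ xs-unique) injective =
    All.tabulate (λ fy∈fxs fx≡fy → let (y , y∈xs , fy≡) = ∈-map⁻ f fy∈fxs in
                   All.lookup x∉xs y∈xs (injective (here refl) (there y∈xs) (trans fx≡fy fy≡)))
    ∷ Unique-map⁺ xs-unique (λ x∈ y∈ → injective (there x∈) (there y∈))

  HasCard-image : ∀ {P : B → Set} {p} {xs : List A} → HasCard P p → Unique xs →
                  (∀ {x y} → x ∈ xs → y ∈ xs → f x ≡ f y → x ≡ y) →
                  (∀ {y} → P y ⇔ ∃ λ x → x ∈ xs × y ≡ f x) → length xs ≡ p
  HasCard-image {xs = xs} card xs-unique injective P⇔image =
    trans (sym (length-map f xs)) (HasCard-length card (Unique-map⁺ xs-unique injective) (⇔-sym P⇔image ⇔-∘ ∈-map))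
    where
    ∈-map : ∀ {y} → y ∈ map f xs ⇔ ∃ λ x → x ∈ xs × y ≡ f x
    ∈-map = mk⇔ (∈-map⁻ f) (λ (x , x∈xs , y≡fx) → subst (_∈ map f xs) (sym y≡fx) (∈-map⁺ f x∈xs))

HasCard-resp-⇔ : ∀ {A : Set} {P Q : A → Set} {p} → (∀ {x} → P x ⇔ Q x) → HasCard P p → HasCard Q p
HasCard-resp-⇔ P⇔Q (xs , xs-unique , ∈xs⇔P , |xs|≡p) =
  xs , xs-unique , (λ x → P⇔Q ⇔-∘ ∈xs⇔P x) , |xs|≡p

·-identityˡ : ∀ {n} (w : Pt n) → (+ 1) · w ≡ w
·-identityˡ []       = refl
·-identityˡ (x ∷ xs) = cong₂ _∷_ (ℤₚ.*-identityˡ x) (·-identityˡ xs)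

⊕-0· : ∀ {n} (a w : Pt n) → a ⊕ (+ 0) · w ≡ a
⊕-0· []       []       = refl
⊕-0· (a ∷ as) (w ∷ ws) = cong₂ _∷_ (ℤₚ.+-identityʳ a) (⊕-0· as ws)

⊕-·-+ : ∀ {n} (a w : Pt n) x y → (a ⊕ x · w) ⊕ y · w ≡ a ⊕ (x ℤ.+ y) · w
⊕-·-+ []       []       x y = refl
⊕-·-+ (a ∷ as) (w ∷ ws) x y = cong₂ _∷_ (distrib a w x y) (⊕-·-+ as ws x y)
  where
  distrib : ∀ a w x y → (a ℤ.+ x ℤ.* w) ℤ.+ y ℤ.* w ≡ a ℤ.+ (x ℤ.+ y) ℤ.* w
  distrib = solve-∀

·-neg : ∀ {n} c (w : Pt n) → c · neg w ≡ (ℤ.- c) · w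
·-neg c []       = refl
·-neg c (w ∷ ws) = cong₂ _∷_ (trans (sym (ℤₚ.neg-distribʳ-* c w)) (ℤₚ.neg-distribˡ-* c w)) (·-neg c ws)

⊖-⊕-neg : ∀ {n} (a w : Pt n) → a ⊖ w ≡ a ⊕ neg w
⊖-⊕-neg []       []       = refl
⊖-⊕-neg (a ∷ as) (w ∷ ws) = cong (_ ∷_) (⊖-⊕-neg as ws)

neg-involutive : ∀ {n} (w : Pt n) → neg (neg w) ≡ w
neg-involutive []       = refl
neg-involutive (w ∷ ws) = cong₂ _∷_ (ℤₚ.neg-involutive w) (neg-involutive ws)

⊕-cancelˡ : ∀ {n} (a x y : Pt n) → a ⊕ x ≡ a ⊕ y → x ≡ y
⊕-cancelˡ []       []       []       _ = refl
⊕-cancelˡ (a ∷ as) (x ∷ xs) (y ∷ ys) e =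
  cong₂ _∷_ (+-cancelˡ a x y (∷-injectiveˡ e)) (⊕-cancelˡ as xs ys (∷-injectiveʳ e))

⊖-⇒-⊕ : ∀ {n} (a b c : Pt n) → b ⊖ a ≡ c → b ≡ a ⊕ c
⊖-⇒-⊕ []       []       []       _ = refl
⊖-⇒-⊕ (a ∷ as) (b ∷ bs) (c ∷ cs) e =
  cong₂ _∷_ (trans (rearrange a b) (cong (ℤ._+_ a) (∷-injectiveˡ e))) (⊖-⇒-⊕ as bs cs (∷-injectiveʳ e))
  where
  rearrange : ∀ a b → b ≡ a ℤ.+ (b ℤ.- a)
  rearrange = solve-∀

·⊖·-injective : ∀ {n} N ca cb (a b w : Pt n) →
                N · a ⊖ ca · w ≡ N · b ⊖ cb · w → N · (b ⊖ a) ≡ (cb ℤ.- ca) · w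
·⊖·-injective N ca cb []       []       []       _ = refl
·⊖·-injective N ca cb (a ∷ as) (b ∷ bs) (w ∷ ws) e =
  cong₂ _∷_ head (·⊖·-injective N ca cb as bs ws (∷-injectiveʳ e))
  where
  open ≡-Reasoning
  p = N ℤ.* a ℤ.- ca ℤ.* w
  q = N ℤ.* b ℤ.- cb ℤ.* w
  regroup : ∀ N a b ca cb w →
            N ℤ.* (b ℤ.- a) ≡ (N ℤ.* b ℤ.- cb ℤ.* w) ℤ.- (N ℤ.* a ℤ.- ca ℤ.* w) ℤ.+ (cb ℤ.- ca) ℤ.* w
  regroup = solve-∀
  cancel : ∀ q r → q ℤ.- q ℤ.+ r ≡ r
  cancel = solve-∀
  head : N ℤ.* (b ℤ.- a) ≡ (cb ℤ.- ca) ℤ.* w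
  head = begin
    N ℤ.* (b ℤ.- a)                 ≡⟨ regroup N a b ca cb w ⟩
    q ℤ.- p ℤ.+ (cb ℤ.- ca) ℤ.* w   ≡⟨ cong (λ t → q ℤ.- t ℤ.+ (cb ℤ.- ca) ℤ.* w) (∷-injectiveˡ e) ⟩
    q ℤ.- q ℤ.+ (cb ℤ.- ca) ℤ.* w   ≡⟨ cancel q _ ⟩
    (cb ℤ.- ca) ℤ.* w               ∎

⊖-as-· : ∀ {n} (a w : Pt n) → a ⊖ w ≡ a ⊕ (ℤ.- + 1) · w
⊖-as-· a w = trans (⊖-⊕-neg a w) (cong (a ⊕_) (trans (sym (·-identityˡ (neg w))) (·-neg (+ 1) w)))

⊕-·-inverse : ∀ {n} (a b w : Pt n) z → b ≡ a ⊕ z · w → a ≡ b ⊕ (ℤ.- z) · w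
⊕-·-inverse a _ w z refl = sym (begin
  (a ⊕ z · w) ⊕ (ℤ.- z) · w ≡⟨ ⊕-·-+ a w z (ℤ.- z) ⟩
  a ⊕ (z ℤ.+ ℤ.- z) · w     ≡⟨ cong (λ c → a ⊕ c · w) (ℤₚ.+-inverseʳ z) ⟩
  a ⊕ (+ 0) · w             ≡⟨ ⊕-0· a w ⟩
  a                         ∎)
  where open ≡-Reasoning

neg-injective : ∀ {n} {x y : Pt n} → neg x ≡ neg y → x ≡ y
neg-injective {x = x} {y} e = trans (sym (neg-involutive x)) (trans (cong neg e) (neg-involutive y))

-- Inner products and primitive vectors

inner-⊕-· : ∀ {n} (a b w : Pt n) z → inner (a ⊕ z · b) w ≡ inner a w ℤ.+ z ℤ.* inner b w
inner-⊕-· []       []       []       z = sym (trans (ℤₚ.+-identityˡ _) (ℤₚ.*-zeroʳ z))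
inner-⊕-· (a ∷ as) (b ∷ bs) (w ∷ ws) z =
  trans (cong (ℤ._+_ ((a ℤ.+ z ℤ.* b) ℤ.* w)) (inner-⊕-· as bs ws z)) (distrib a b w z (inner as ws) (inner bs ws))
  where
  distrib : ∀ a b w z i j →
            (a ℤ.+ z ℤ.* b) ℤ.* w ℤ.+ (i ℤ.+ z ℤ.* j) ≡ (a ℤ.* w ℤ.+ i) ℤ.+ z ℤ.* (b ℤ.* w ℤ.+ j)
  distrib = solve-∀

inner-neg : ∀ {n} (a w : Pt n) → inner a (neg w) ≡ ℤ.- inner a w
inner-neg []       []       = refl
inner-neg (a ∷ as) (w ∷ ws) =
  trans (cong₂ ℤ._+_ (sym (ℤₚ.neg-distribʳ-* a w)) (inner-neg as ws)) (sym (ℤₚ.neg-distrib-+ (a ℤ.* w) (inner as ws)))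

sumSq : ∀ {n} → Pt n → ℕ
sumSq []       = 0
sumSq (x ∷ xs) = ∣ x ∣ ℕ.* ∣ x ∣ ℕ.+ sumSq xs

inner-self : ∀ {n} (w : Pt n) → inner w w ≡ + sumSq w
inner-self []       = refl
inner-self (x ∷ xs) = trans (cong₂ ℤ._+_ (square x) (inner-self xs)) (sym (ℤₚ.pos-+ _ (sumSq xs)))
  where
  square : ∀ x → x ℤ.* x ≡ + (∣ x ∣ ℕ.* ∣ x ∣)
  square (+ k)    = sym (ℤₚ.pos-* k k)
  square -[1+ k ] = refl

normSq≡sumSq : ∀ {n} (w : Pt n) → normSq w ≡ sumSq w
normSq≡sumSq w = cong ∣_∣ (inner-self w)

inner-self≡normSq : ∀ {n} (w : Pt n) → inner w w ≡ + normSq w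
inner-self≡normSq w = trans (inner-self w) (cong +_ (sym (normSq≡sumSq w)))

normSq-neg : ∀ {n} (w : Pt n) → normSq (neg w) ≡ normSq w
normSq-neg w = trans (normSq≡sumSq (neg w)) (trans (sumSq-neg w) (sym (normSq≡sumSq w)))
  where
  sumSq-neg : ∀ {n} (w : Pt n) → sumSq (neg w) ≡ sumSq w
  sumSq-neg []       = refl
  sumSq-neg (x ∷ xs) = cong₂ (λ a b → a ℕ.* a ℕ.+ b) (ℤₚ.∣-i∣≡∣i∣ x) (sumSq-neg xs)

gcdEntries-neg : ∀ {n} (w : Pt n) → gcdEntries (neg w) ≡ gcdEntries w
gcdEntries-neg []       = refl
gcdEntries-neg (x ∷ xs) = cong₂ gcd (ℤₚ.∣-i∣≡∣i∣ x) (gcdEntries-neg xs)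

sumSq≡0⇒gcdEntries≡0 : ∀ {n} (w : Pt n) → sumSq w ≡ 0 → gcdEntries w ≡ 0
sumSq≡0⇒gcdEntries≡0 []       _ = refl
sumSq≡0⇒gcdEntries≡0 (x ∷ xs) e
  with ℕₚ.m*n≡0⇒m≡0∨n≡0 ∣ x ∣ (ℕₚ.m+n≡0⇒m≡0 _ e)
     | sumSq≡0⇒gcdEntries≡0 xs (ℕₚ.m+n≡0⇒n≡0 (∣ x ∣ ℕ.* ∣ x ∣) e)
... | inj₁ x≡0 | g≡0 rewrite x≡0 | g≡0 = refl
... | inj₂ x≡0 | g≡0 rewrite x≡0 | g≡0 = refl

normSq-primitive : ∀ {n} (w : Pt n) → Primitive w → Σ ℕ λ m → normSq w ≡ suc m
normSq-primitive w prim with sumSq w in eq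
... | suc m = m , trans (normSq≡sumSq w) eq
... | zero with () ← trans (sym (sumSq≡0⇒gcdEntries≡0 w eq)) prim

module _ (m : ℕ) where
  private
    N : ℤ
    N = + suc m

  ·-∣-gcdEntries : ∀ {n} (x w : Pt n) d → N · x ≡ d · w → suc m ∣ ∣ d ∣ ℕ.* gcdEntries w
  ·-∣-gcdEntries []       []       d _ = divides 0 (ℕₚ.*-zeroʳ ∣ d ∣)
  ·-∣-gcdEntries (x ∷ xs) (w ∷ ws) d e =
    subst (suc m ∣_) (sym (c*gcd[m,n]≡gcd[cm,cn] ∣ d ∣ ∣ w ∣ (gcdEntries ws)))
      (gcd-greatest (divides ∣ x ∣ head) (·-∣-gcdEntries xs ws d (∷-injectiveʳ e)))
    where
    open ≡-Reasoning
    head : ∣ d ∣ ℕ.* ∣ w ∣ ≡ ∣ x ∣ ℕ.* suc m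
    head = begin
      ∣ d ∣ ℕ.* ∣ w ∣   ≡⟨ ℤₚ.abs-* d w ⟨
      ∣ d ℤ.* w ∣       ≡⟨ cong ∣_∣ (∷-injectiveˡ e) ⟨
      ∣ N ℤ.* x ∣       ≡⟨ ℤₚ.abs-* N x ⟩
      suc m ℕ.* ∣ x ∣   ≡⟨ ℕₚ.*-comm (suc m) _ ⟩
      ∣ x ∣ ℕ.* suc m   ∎

  ·-cancel : ∀ {n} (x w : Pt n) z → N · x ≡ (z ℤ.* N) · w → x ≡ z · w
  ·-cancel []       []       z _ = refl
  ·-cancel (x ∷ xs) (w ∷ ws) z e =
    cong₂ _∷_ (ℤₚ.*-cancelˡ-≡ N x (z ℤ.* w) (trans (∷-injectiveˡ e) (reassoc z N w)))
              (·-cancel xs ws z (∷-injectiveʳ e))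
    where
    reassoc : ∀ z n w → (z ℤ.* n) ℤ.* w ≡ n ℤ.* (z ℤ.* w)
    reassoc = solve-∀

  primitive-multiple : ∀ {n} (x w : Pt n) d → Primitive w → N · x ≡ d · w → Σ ℤ λ z → x ≡ z · w
  primitive-multiple x w d prim e
    with ∣ᵤ⇒∣ {N} {d} (subst (suc m ∣_) (trans (cong (∣ d ∣ ℕ.*_) prim) (ℕₚ.*-identityʳ _))
                                        (·-∣-gcdEntries x w d e))
  ... | divides z d≡zN = z , ·-cancel x w z (trans e (cong (_· w) d≡zN))

-- The projection P_w

/-injective : ∀ p q m → p / suc m ≡ q / suc m → p ≡ q
/-injective p q m e with ℚₚ.fromℚᵘ-injective {mkℚᵘ p m} {mkℚᵘ q m} e
... | *≡* eq = ℤₚ.*-cancelʳ-≡ p q (+ suc m) eq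

x-[c/N]*y≡[Nx-cy]/N : ∀ x c y m → (x / 1) ℚ.- (c / suc m) ℚ.* (y / 1) ≡ (+ suc m ℤ.* x ℤ.- c ℤ.* y) / suc m
x-[c/N]*y≡[Nx-cy]/N x c y m = ℚₚ.toℚᵘ-injective (begin
  ⟦ X ℚ.- C ℚ.* Y ⟧                           ≈⟨ ℚₚ.toℚᵘ-homo-+ X (ℚ.- (C ℚ.* Y)) ⟩
  ⟦ X ⟧ ℚᵘ.+ ⟦ ℚ.- (C ℚ.* Y) ⟧                 ≈⟨ ℚᵘₚ.+-cong X≃ (ℚᵘₚ.≃-trans (ℚₚ.toℚᵘ-homo‿- (C ℚ.* Y)) (ℚᵘₚ.-‿cong CY≃)) ⟩
  mkℚᵘ x 0 ℚᵘ.- mkℚᵘ c m ℚᵘ.* mkℚᵘ y 0         ≈⟨ *≡* cross ⟩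
  mkℚᵘ (+ suc m ℤ.* x ℤ.- c ℤ.* y) m           ≈⟨ ℚₚ.toℚᵘ-fromℚᵘ _ ⟨
  ⟦ (+ suc m ℤ.* x ℤ.- c ℤ.* y) / suc m ⟧      ∎)
  where
  open ℚᵘₚ.≃-Reasoning
  ⟦_⟧ = ℚ.toℚᵘ
  X = x / 1
  C = c / suc m
  Y = y / 1
  X≃ : ⟦ X ⟧ ℚᵘ.≃ mkℚᵘ x 0
  X≃ = ℚₚ.toℚᵘ-fromℚᵘ (mkℚᵘ x 0)
  CY≃ : ⟦ C ℚ.* Y ⟧ ℚᵘ.≃ mkℚᵘ c m ℚᵘ.* mkℚᵘ y 0
  CY≃ = ℚᵘₚ.≃-trans (ℚₚ.toℚᵘ-homo-* C Y)
                    (ℚᵘₚ.*-cong (ℚₚ.toℚᵘ-fromℚᵘ (mkℚᵘ c m)) (ℚₚ.toℚᵘ-fromℚᵘ (mkℚᵘ y 0)))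
  cross : (x ℤ.* + suc (m ℕ.* 1) ℤ.+ ℤ.- (c ℤ.* y) ℤ.* + 1) ℤ.* + suc m
          ≡ (+ suc m ℤ.* x ℤ.- c ℤ.* y) ℤ.* + suc (m ℕ.* 1 ℕ.+ 0)
  cross rewrite ℕₚ.*-identityʳ m | ℕₚ.+-identityʳ m = ring x c y (+ suc m)
    where
    ring : ∀ x c y n → (x ℤ.* n ℤ.+ ℤ.- (c ℤ.* y) ℤ.* + 1) ℤ.* n ≡ (n ℤ.* x ℤ.- c ℤ.* y) ℤ.* n
    ring = solve-∀

projCoef-nonzero : ∀ {n} (u w : Pt n) {m} → normSq w ≡ suc m → projCoef u w ≡ inner u w / suc m
projCoef-nonzero u w eq with normSq w
projCoef-nonzero u w refl | .(suc _) = refl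

module Projection {n} (w : Pt n) (m : ℕ) (‖w‖²≡1+m : normSq w ≡ suc m) where

  N : ℤ
  N = + suc m

  scaledProj : Pt n → Pt n
  scaledProj a = N · a ⊖ inner a w · w

  proj≡scaledProj/N : ∀ a → proj w a ≡ Vec.map (_/ suc m) (scaledProj a)
  proj≡scaledProj/N a rewrite projCoef-nonzero a w ‖w‖²≡1+m = entrywise (inner a w) a w
    where
    entrywise : ∀ {k} c (xs ys : Vec ℤ k) →
      zipWith (λ x y → (x / 1) ℚ.- (c / suc m) ℚ.* (y / 1)) xs ys ≡ Vec.map (_/ suc m) (N · xs ⊖ c · ys)
    entrywise c []       []       = refl
    entrywise c (x ∷ xs) (y ∷ ys) = cong₂ _∷_ (x-[c/N]*y≡[Nx-cy]/N x c y m) (entrywise c xs ys)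

  scaledProj-shift : ∀ a z → scaledProj (a ⊕ z · w) ≡ scaledProj a
  scaledProj-shift a z rewrite inner-⊕-· a w w z | inner-self≡normSq w | ‖w‖²≡1+m = entrywise (inner a w) a w
    where
    shift : ∀ n z x y c → n ℤ.* (x ℤ.+ z ℤ.* y) ℤ.- (c ℤ.+ z ℤ.* n) ℤ.* y ≡ n ℤ.* x ℤ.- c ℤ.* y
    shift = solve-∀
    entrywise : ∀ {k} c (xs ys : Vec ℤ k) → N · (xs ⊕ z · ys) ⊖ (c ℤ.+ z ℤ.* N) · ys ≡ N · xs ⊖ c · ys
    entrywise c []       []       = refl
    entrywise c (x ∷ xs) (y ∷ ys) = cong₂ _∷_ (shift N z x y c) (entrywise c xs ys)

  proj-shift : ∀ a z → proj w (a ⊕ z · w) ≡ proj w a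
  proj-shift a z = begin
    proj w (a ⊕ z · w)                          ≡⟨ proj≡scaledProj/N (a ⊕ z · w) ⟩
    Vec.map (_/ suc m) (scaledProj (a ⊕ z · w)) ≡⟨ cong (Vec.map (_/ suc m)) (scaledProj-shift a z) ⟩
    Vec.map (_/ suc m) (scaledProj a)           ≡⟨ proj≡scaledProj/N a ⟨
    proj w a                                    ∎
    where open ≡-Reasoning

  scaledProj-injective : ∀ {a b} → proj w a ≡ proj w b → scaledProj a ≡ scaledProj b
  scaledProj-injective {a} {b} e = map-/-injective _ _ (trans (sym (proj≡scaledProj/N a)) (trans e (proj≡scaledProj/N b)))
    where
    map-/-injective : ∀ {k} (xs ys : Vec ℤ k) → Vec.map (_/ suc m) xs ≡ Vec.map (_/ suc m) ys → xs ≡ ys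
    map-/-injective []       []       _ = refl
    map-/-injective (x ∷ xs) (y ∷ ys) e =
      cong₂ _∷_ (/-injective x y m (∷-injectiveˡ e)) (map-/-injective xs ys (∷-injectiveʳ e))

  proj-injective : Primitive w → ∀ a b → proj w a ≡ proj w b → Σ ℤ λ z → b ≡ a ⊕ z · w
  proj-injective prim a b e
    with primitive-multiple m (b ⊖ a) w (inner b w ℤ.- inner a w) prim
           (·⊖·-injective N (inner a w) (inner b w) a b w (scaledProj-injective e))
  ... | z , b⊖a≡z·w = z , ⊖-⇒-⊕ a b (z · w) b⊖a≡z·w

proj-neg : ∀ {n} (w : Pt n) {m} → normSq w ≡ suc m → ∀ a → proj (neg w) a ≡ proj w a
proj-neg w {m} ‖w‖²≡1+m a = begin
  proj (neg w) a                          ≡⟨ P⁻.proj≡scaledProj/N a ⟩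
  Vec.map (_/ suc m) (P⁻.scaledProj a)    ≡⟨ cong (λ t → Vec.map (_/ suc m) (P.N · a ⊖ t)) same-component ⟩
  Vec.map (_/ suc m) (P.scaledProj a)     ≡⟨ P.proj≡scaledProj/N a ⟨
  proj w a                                ∎
  where
  open ≡-Reasoning
  module P  = Projection w m ‖w‖²≡1+m
  module P⁻ = Projection (neg w) m (trans (normSq-neg w) ‖w‖²≡1+m)
  same-component : inner a (neg w) · neg w ≡ inner a w · w
  same-component rewrite inner-neg a w | ·-neg (ℤ.- inner a w) w | ℤₚ.neg-involutive (inner a w) = refl

-- Gap-free sets

-- every line c + ℤw meets S in a segment
Convex : ∀ {n} → List (Pt n) → Pt n → Set
Convex S w = ∀ {c} s d → c ∈ S → c ⊕ (+ (s ℕ.+ d)) · w ∈ S → c ⊕ (+ s) · w ∈ S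

module _ {n} {S : List (Pt n)} {w : Pt n} (gap-free : GapEmpty w S) where

  leaves-for-good : ∀ {x} → x ⊖ w ∈ S → x ∉ S → ∀ b → x ⊕ (+ b) · w ∉ S
  leaves-for-good {x} x-w∈S x∉S zero    = x∉S ∘ subst (_∈ S) (⊕-0· x w)
  leaves-for-good {x} x-w∈S x∉S (suc b) x+bw∈S = gap-free x (x-w∈S , x∉S , suc b , s≤s z≤n , x+bw∈S)

  gapEmpty⇒convex : Convex S w
  gapEmpty⇒convex {c} zero    d c∈S _     = subst (_∈ S) (sym (⊕-0· c w)) c∈S
  gapEmpty⇒convex {c} (suc s) d c∈S c+tw∈S = decidable-stable (x ∈? S) λ x∉S →
    leaves-for-good x-w∈S x∉S d (subst (_∈ S) (sym x+dw≡c+tw) c+tw∈S)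
    where
    x = c ⊕ (+ suc s) · w
    x-w∈S : x ⊖ w ∈ S
    x-w∈S = subst (_∈ S) (sym (begin
      x ⊖ w                                 ≡⟨ ⊖-as-· x w ⟩
      x ⊕ (ℤ.- + 1) · w                     ≡⟨ ⊕-·-+ c w (+ suc s) (ℤ.- + 1) ⟩
      c ⊕ (+ suc s ℤ.+ ℤ.- + 1) · w         ≡⟨ cong (λ z → c ⊕ z · w) (pred-suc (+ s)) ⟩
      c ⊕ (+ s) · w                         ∎))
      (gapEmpty⇒convex s (suc d) c∈S (subst (λ t → c ⊕ (+ t) · w ∈ S) (sym (ℕₚ.+-suc s d)) c+tw∈S))
      where
      open ≡-Reasoning
      pred-suc : ∀ s → (+ 1 ℤ.+ s) ℤ.+ ℤ.- + 1 ≡ s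
      pred-suc = solve-∀
    x+dw≡c+tw : x ⊕ (+ d) · w ≡ c ⊕ (+ (suc s ℕ.+ d)) · w
    x+dw≡c+tw = ⊕-·-+ c w (+ suc s) (+ d)

convex-neg : ∀ {n} {S : List (Pt n)} {w : Pt n} → Convex S w → Convex S (neg w)
convex-neg {S = S} {w} convex {c} s d c∈S c-tw∈S =
  subst (_∈ S) c'+dw≡c-sw (convex d s c-tw∈S (subst (_∈ S) (sym c'+d+sw≡c) c∈S))
  where
  open ≡-Reasoning
  c' = c ⊕ (+ (s ℕ.+ d)) · neg w
  c'-as-· : c' ≡ c ⊕ (ℤ.- + (s ℕ.+ d)) · w
  c'-as-· = cong (c ⊕_) (·-neg (+ (s ℕ.+ d)) w)
  c'+d+sw≡c : c' ⊕ (+ (d ℕ.+ s)) · w ≡ c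
  c'+d+sw≡c = begin
    c' ⊕ (+ (d ℕ.+ s)) · w                         ≡⟨ cong (λ p → p ⊕ (+ (d ℕ.+ s)) · w) c'-as-· ⟩
    (c ⊕ (ℤ.- + (s ℕ.+ d)) · w) ⊕ (+ (d ℕ.+ s)) · w ≡⟨ ⊕-·-+ c w (ℤ.- + (s ℕ.+ d)) (+ (d ℕ.+ s)) ⟩
    c ⊕ (ℤ.- + (s ℕ.+ d) ℤ.+ + (d ℕ.+ s)) · w      ≡⟨ cong (λ z → c ⊕ z · w) (cancel (+ s) (+ d)) ⟩
    c ⊕ (+ 0) · w                                  ≡⟨ ⊕-0· c w ⟩
    c                                              ∎
    where
    cancel : ∀ s d → ℤ.- (s ℤ.+ d) ℤ.+ (d ℤ.+ s) ≡ + 0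
    cancel = solve-∀
  c'+dw≡c-sw : c' ⊕ (+ d) · w ≡ c ⊕ (+ s) · neg w
  c'+dw≡c-sw = begin
    c' ⊕ (+ d) · w                          ≡⟨ cong (λ p → p ⊕ (+ d) · w) c'-as-· ⟩
    (c ⊕ (ℤ.- + (s ℕ.+ d)) · w) ⊕ (+ d) · w ≡⟨ ⊕-·-+ c w (ℤ.- + (s ℕ.+ d)) (+ d) ⟩
    c ⊕ (ℤ.- + (s ℕ.+ d) ℤ.+ + d) · w       ≡⟨ cong (λ z → c ⊕ z · w) (cancel (+ s) (+ d)) ⟩
    c ⊕ (ℤ.- + s) · w                       ≡⟨ cong (c ⊕_) (·-neg (+ s) w) ⟨
    c ⊕ (+ s) · neg w                       ∎
    where
    cancel : ∀ s d → ℤ.- (s ℤ.+ d) ℤ.+ d ≡ ℤ.- s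
    cancel = solve-∀

-- Tops of S in direction w

tops : ∀ {n} → List (Pt n) → Pt n → List (Pt n)
tops S w = deduplicate (≡-dec ℤ._≟_) (filter (λ a → a ⊕ w ∉? S) S)

module _ {n} {S : List (Pt n)} {w : Pt n} where

  ∈-tops⁺ : ∀ {a} → a ∈ S → a ⊕ w ∉ S → a ∈ tops S w
  ∈-tops⁺ a∈S a+w∉S = ∈-deduplicate⁺ (≡-dec ℤ._≟_) (∈-filter⁺ (λ a → a ⊕ w ∉? S) a∈S a+w∉S)

  ∈-tops⁻ : ∀ {a} → a ∈ tops S w → a ∈ S × a ⊕ w ∉ S
  ∈-tops⁻ a∈tops = ∈-filter⁻ (λ a → a ⊕ w ∉? S) (∈-deduplicate⁻ (≡-dec ℤ._≟_) _ a∈tops)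

  tops-unique : Unique (tops S w)
  tops-unique = deduplicate-! _

module _ {n} {S : List (Pt n)} {w : Pt n} {m} (‖w‖²≡1+m : normSq w ≡ suc m) where
  open Projection w m ‖w‖²≡1+m

  nothing-above-top : Convex S w → ∀ {a} t → a ∈ tops S w → a ⊕ (+ suc t) · w ∉ S
  nothing-above-top convex {a} t a∈tops a+tw∈S with ∈-tops⁻ a∈tops
  ... | a∈S , a+w∉S = a+w∉S (subst (_∈ S) (cong (a ⊕_) (·-identityˡ w)) (convex 1 t a∈S a+tw∈S))

  proj-tops-injective : Primitive w → Convex S w →
                        ∀ {a b} → a ∈ tops S w → b ∈ tops S w → proj w a ≡ proj w b → a ≡ b
  proj-tops-injective prim convex {a} {b} a∈tops b∈tops e with proj-injective prim a b e
  ... | + zero   , b≡a+0w = sym (trans b≡a+0w (⊕-0· a w))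
  ... | + suc t  , b≡a+tw = ⊥-elim (nothing-above-top convex t a∈tops
                                      (subst (_∈ S) b≡a+tw (proj₁ (∈-tops⁻ b∈tops))))
  ... | -[1+ t ] , b≡a-tw = ⊥-elim (nothing-above-top convex t b∈tops
                                      (subst (_∈ S) (⊕-·-inverse a b w -[1+ t ] b≡a-tw) (proj₁ (∈-tops⁻ a∈tops))))

  inner<inner-⊕ : ∀ a → inner a w ℤ.< inner (a ⊕ w) w
  inner<inner-⊕ a = subst₂ ℤ._<_ (ℤₚ.+-identityʳ (inner a w)) (sym a+w·w) (ℤₚ.+-monoʳ-< (inner a w) (ℤ.+<+ ℕ.z<s))
    where
    open ≡-Reasoning
    a+w·w : inner (a ⊕ w) w ≡ inner a w ℤ.+ N
    a+w·w = begin
      inner (a ⊕ w) w                        ≡⟨ cong (λ b → inner b w) (cong (a ⊕_) (·-identityˡ w)) ⟨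
      inner (a ⊕ (+ 1) · w) w                ≡⟨ inner-⊕-· a w w (+ 1) ⟩
      inner a w ℤ.+ + 1 ℤ.* inner w w        ≡⟨ cong (ℤ._+_ (inner a w)) (ℤₚ.*-identityˡ _) ⟩
      inner a w ℤ.+ inner w w                ≡⟨ cong (ℤ._+_ (inner a w)) (inner-self≡normSq w) ⟩
      inner a w ℤ.+ + normSq w               ≡⟨ cong (λ k → inner a w ℤ.+ + k) ‖w‖²≡1+m ⟩
      inner a w ℤ.+ N                        ∎

  -- the point of the fibre of u that is furthest in direction w is a top
  tops-cover-fibres : ∀ {u} → u ∈ S → ∃ λ a → a ∈ tops S w × proj w u ≡ proj w a
  tops-cover-fibres {u} u∈S = a , ∈-tops⁺ (proj₁ a-in-fibre) a+w∉S , sym (proj₂ a-in-fibre)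
    where
    same-fibre? = λ b → ≡-dec ℚ._≟_ (proj w b) (proj w u)
    fibre = filter same-fibre? S
    a = argmax (λ b → inner b w) u fibre
    a-in-fibre : a ∈ S × proj w a ≡ proj w u
    a-in-fibre = argmax-all (λ b → inner b w) (u∈S , refl) (All.tabulate (∈-filter⁻ same-fibre?))
    a+w∉S : a ⊕ w ∉ S
    a+w∉S a+w∈S = ℤₚ.<⇒≱ (inner<inner-⊕ a) (All.lookup (f[xs]≤f[argmax] {f = λ b → inner b w} u fibre) a+w∈fibre)
      where
      a+w∈fibre : a ⊕ w ∈ fibre
      a+w∈fibre = ∈-filter⁺ same-fibre? a+w∈S
        (trans (cong (proj w) (cong (a ⊕_) (sym (·-identityˡ w)))) (trans (proj-shift a (+ 1)) (proj₂ a-in-fibre)))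

length-tops : ∀ {n} {S : List (Pt n)} {w : Pt n} {p} → Primitive w → Convex S w →
              HasCard (InProj w S) p → length (tops S w) ≡ p
length-tops {S = S} {w} prim convex card with normSq-primitive w prim
... | m , ‖w‖²≡1+m =
  HasCard-image (proj w) card (tops-unique {S = S} {w}) (proj-tops-injective ‖w‖²≡1+m prim convex)
                (mk⇔ top-of-fibre fibre-of-top)
  where
  top-of-fibre : ∀ {y} → InProj w S y → ∃ λ a → a ∈ tops S w × y ≡ proj w a
  top-of-fibre (u , u∈S , refl) = tops-cover-fibres ‖w‖²≡1+m u∈S
  fibre-of-top : ∀ {y} → (∃ λ a → a ∈ tops S w × y ≡ proj w a) → InProj w S y
  fibre-of-top (a , a∈tops , y≡pa) = a , proj₁ (∈-tops⁻ a∈tops) , sym y≡pa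

length-tops± : ∀ {n} {S : List (Pt n)} {w : Pt n} {p} → Primitive w → GapEmpty w S →
               HasCard (InProj w S) p → length (tops S w) ≡ p × length (tops S (neg w)) ≡ p
length-tops± {S = S} {w} prim gap-free card with normSq-primitive w prim
... | m , ‖w‖²≡1+m =
  length-tops prim convex card ,
  length-tops (trans (gcdEntries-neg w) prim) (convex-neg convex) (HasCard-resp-⇔ same-projection card)
  where
  convex = gapEmpty⇒convex gap-free
  same-projection : ∀ {y} → InProj w S y ⇔ InProj (neg w) S y
  same-projection = mk⇔ (λ (a , a∈S , e) → a , a∈S , trans (proj-neg w ‖w‖²≡1+m a) e)
                        (λ (a , a∈S , e) → a , a∈S , trans (sym (proj-neg w ‖w‖²≡1+m a)) e)

-- Boundary edges

module _ {n : ℕ} (S : List (Pt n)) where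

  outEdges : Pt n → List (Pt n × Pt n)
  outEdges w = map (λ a → a , a ⊕ w) (tops S w)

  edgesAlong : Pt n → List (Pt n × Pt n)
  edgesAlong w = outEdges w ++ outEdges (neg w)

  boundaryEdges : ∀ {k} → (Fin k → Pt n) → List (Pt n × Pt n)
  boundaryEdges {zero}  v = []
  boundaryEdges {suc k} v = edgesAlong (v zero) ++ boundaryEdges (v ∘ suc)

  ∈-outEdges⁺ : ∀ {w a} → a ∈ S → a ⊕ w ∉ S → (a , a ⊕ w) ∈ outEdges w
  ∈-outEdges⁺ a∈S a+w∉S = ∈-map⁺ _ (∈-tops⁺ a∈S a+w∉S)

  ∈-outEdges⁻ : ∀ {w a b} → (a , b) ∈ outEdges w → b ≡ a ⊕ w × a ∈ S × b ∉ S
  ∈-outEdges⁻ ab∈out with ∈-map⁻ _ ab∈out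
  ... | a , a∈tops , refl = refl , ∈-tops⁻ a∈tops

  ∈-edgesAlong : ∀ {w a b} → (a , b) ∈ edgesAlong w ⇔ ((b ≡ a ⊕ w ⊎ b ≡ a ⊖ w) × a ∈ S × b ∉ S)
  ∈-edgesAlong {w} {a} {b} = mk⇔ to from
    where
    to : (a , b) ∈ edgesAlong w → (b ≡ a ⊕ w ⊎ b ≡ a ⊖ w) × a ∈ S × b ∉ S
    to ab∈ with ∈-++⁻ (outEdges w) ab∈
    ... | inj₁ ab∈out = let (b≡ , rest) = ∈-outEdges⁻ ab∈out in inj₁ b≡ , rest
    ... | inj₂ ab∈out = let (b≡ , rest) = ∈-outEdges⁻ ab∈out in inj₂ (trans b≡ (sym (⊖-⊕-neg a w))) , rest
    from : (b ≡ a ⊕ w ⊎ b ≡ a ⊖ w) × a ∈ S × b ∉ S → (a , b) ∈ edgesAlong w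
    from (inj₁ refl , a∈S , b∉S) = ∈-++⁺ˡ (∈-outEdges⁺ a∈S b∉S)
    from (inj₂ refl , a∈S , b∉S) = ∈-++⁺ʳ (outEdges w) (subst (λ b → (a , b) ∈ outEdges (neg w)) (sym a-w≡a+[-w])
                                                          (∈-outEdges⁺ a∈S (subst (_∉ S) a-w≡a+[-w] b∉S)))
      where
      a-w≡a+[-w] = ⊖-⊕-neg a w

  ∈-boundaryEdges : ∀ {k} (v : Fin k → Pt n) {e} → e ∈ boundaryEdges v ⇔ BoundaryEdge v S e
  ∈-boundaryEdges {zero}  v {a , b} = mk⇔ (λ ()) (λ { ((() , _) , _) })
  ∈-boundaryEdges {suc k} v {a , b} = mk⇔ to from
    where
    to : (a , b) ∈ boundaryEdges v → BoundaryEdge v S (a , b)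
    to ab∈ with ∈-++⁻ (edgesAlong (v zero)) ab∈
    ... | inj₁ ab∈along = let (step , rest) = Equivalence.to ∈-edgesAlong ab∈along in (zero , step) , rest
    ... | inj₂ ab∈rest  = let ((i , step) , rest) = Equivalence.to (∈-boundaryEdges (v ∘ suc)) ab∈rest
                          in (suc i , step) , rest
    from : BoundaryEdge v S (a , b) → (a , b) ∈ boundaryEdges v
    from ((zero  , step) , rest) = ∈-++⁺ˡ (Equivalence.from ∈-edgesAlong (step , rest))
    from ((suc i , step) , rest) =
      ∈-++⁺ʳ (edgesAlong (v zero)) (Equivalence.from (∈-boundaryEdges (v ∘ suc)) ((i , step) , rest))

  private
    step-cancel : ∀ {a b x y : Pt n} → b ≡ a ⊕ x → b ≡ a ⊕ y → x ≡ y
    step-cancel {a} b≡a+x b≡a+y = ⊕-cancelˡ a _ _ (trans (sym b≡a+x) b≡a+y)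

    back-step : ∀ {a b w : Pt n} → b ≡ a ⊖ w → b ≡ a ⊕ neg w
    back-step {a} {w = w} b≡a-w = trans b≡a-w (⊖-⊕-neg a w)

  outEdges-unique : ∀ w → Unique (outEdges w)
  outEdges-unique w = map⁺ (cong proj₁) (tops-unique {S = S} {w})

  edgesAlong-unique : ∀ {w} → w ≢ neg w → Unique (edgesAlong w)
  edgesAlong-unique {w} w≢-w = ++⁺ (outEdges-unique w) (outEdges-unique (neg w))
    λ { (ab∈out , ab∈out-neg) → w≢-w (step-cancel (proj₁ (∈-outEdges⁻ ab∈out)) (proj₁ (∈-outEdges⁻ ab∈out-neg))) }

  boundaryEdges-unique : ∀ {k} (v : Fin k → Pt n) → (∀ i j → v i ≡ v j → i ≡ j) → (∀ i j → v i ≢ neg (v j)) →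
                         Unique (boundaryEdges v)
  boundaryEdges-unique {zero}  v distinct notOpp = []
  boundaryEdges-unique {suc k} v distinct notOpp =
    ++⁺ (edgesAlong-unique (notOpp zero zero))
        (boundaryEdges-unique (v ∘ suc) (λ i j → suc-injective ∘ distinct (suc i) (suc j)) (λ i j → notOpp (suc i) (suc j)))
        λ { {a , b} (ab∈along , ab∈rest) →
              different-steps (proj₁ (Equivalence.to ∈-edgesAlong ab∈along))
                              (proj₁ (Equivalence.to (∈-boundaryEdges (v ∘ suc)) ab∈rest)) }
    where
    different-steps : ∀ {a b} → (b ≡ a ⊕ v zero ⊎ b ≡ a ⊖ v zero) → Adj (v ∘ suc) a b → ⊥
    different-steps (inj₁ p) (i , inj₁ q) with () ← distinct zero (suc i) (step-cancel p q)
    different-steps (inj₁ p) (i , inj₂ q) = notOpp zero (suc i) (step-cancel p (back-step q))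
    different-steps (inj₂ p) (i , inj₁ q) = notOpp (suc i) zero (step-cancel q (back-step p))
    different-steps (inj₂ p) (i , inj₂ q)
      with () ← distinct zero (suc i) (neg-injective (step-cancel (back-step p) (back-step q)))

  length-boundaryEdges : ∀ {k} (v : Fin k → Pt n) (p : Fin k → ℕ) →
                         (∀ i → length (tops S (v i)) ≡ p i × length (tops S (neg (v i))) ≡ p i) →
                         length (boundaryEdges v) ≡ 2 * sum (tabulate p)
  length-boundaryEdges {zero}  v p lengths = refl
  length-boundaryEdges {suc k} v p lengths = begin
    length (boundaryEdges v)                                           ≡⟨ length-++ (edgesAlong (v zero)) ⟩
    length (edgesAlong (v zero)) ℕ.+ length (boundaryEdges (v ∘ suc))  ≡⟨ cong₂ ℕ._+_ along rest ⟩
    (p zero ℕ.+ p zero) ℕ.+ 2 * sum (tabulate (p ∘ suc))               ≡⟨ double (p zero) (sum (tabulate (p ∘ suc))) ⟩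
    2 * sum (tabulate p)                                               ∎
    where
    open ≡-Reasoning
    double : ∀ a s → (a ℕ.+ a) ℕ.+ 2 * s ≡ 2 * (a ℕ.+ s)
    double = ℕ-Solver.solve-∀
    out : ∀ w → length (outEdges w) ≡ length (tops S w)
    out w = length-map _ (tops S w)
    along : length (edgesAlong (v zero)) ≡ p zero ℕ.+ p zero
    along = trans (length-++ (outEdges (v zero)))
                  (cong₂ ℕ._+_ (trans (out (v zero)) (proj₁ (lengths zero)))
                               (trans (out (neg (v zero))) (proj₂ (lengths zero))))
    rest : length (boundaryEdges (v ∘ suc)) ≡ 2 * sum (tabulate (p ∘ suc))
    rest = length-boundaryEdges (v ∘ suc) (p ∘ suc) (lengths ∘ suc)

corollary1 : ∀ (n k : ℕ) (v : Fin k → Pt n) → IsPL v →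
    (S : List (Pt n)) → (∀ i → GapEmpty (v i) S) →
    (p : Fin k → ℕ) → (∀ i → HasCard (InProj (v i) S) (p i)) →
    (m : ℕ) → HasCard (BoundaryEdge v S) m →
    m ≡ 2 * sum (tabulate p)
corollary1 _ _ v pl S gap-free p projections m boundary = begin
  m                            ≡⟨ HasCard-length boundary (boundaryEdges-unique S v distinct notOpp) (∈-boundaryEdges S v) ⟨
  length (boundaryEdges S v)   ≡⟨ length-boundaryEdges S v p (λ i → length-tops± (coprime i) (gap-free i) (projections i)) ⟩
  2 * sum (tabulate p)         ∎
  where
  open ≡-Reasoning
  open IsPL pl
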